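{- Let $\mathbf{x}$ be a vector of variables, $m\in\mathbb{N}$ and $p\in\mathbb{PE}[\mathbf{x}]$. Then one can compute a $q\in\mathbb{PE}[\mathbf{x}]$ which is equivalent to $\sum_{i=1}^{n} m^{n-i}\cdot p[n/i-1]$, i.e., both evaluate to the same value for every $n\in\mathbb{N}$ and every assignment of the variables $\mathbf{x}$.
   Context: $n$ is a designated variable ranging over $\mathbb{N}$. $\mathbb{A}\mathbf{f}[\mathbf{x}]$ denotes the set of affine expressions $\mathbf{c}^T\mathbf{x}+c$ with $\mathbf{c}$, $c$ rational. Let $\mathcal{C}$ be the set of finite conjunctions of literals $n=c$ and $n\neq c$ with $c\in\mathbb{N}$; for a formula $\psi$ over $n$, $[\![\psi]\!]$ is its characteristic function ($[\![\psi]\!](c)=1$ if $\psi[n/c]$ holds, else $0$). The poly-exponential expressions over $\mathbf{x}$ are $\mathbb{PE}[\mathbf{x}]=\{\sum_{j=1}^{\ell}[\![\psi_j]\!]\cdot\alpha_j\cdot n^{a_j}\cdot b_j^n \mid \ell,a_j\in\mathbb{N},\ \psi_j\in\mathcal{C},\ \alpha_j\in\mathbb{A}\mathbf{f}[\mathbf{x}],\ b_j\in\mathbb{N}_{\ge1}\}$. $p[n/t]$ denotes substitution of $t$ for $n$ in $p$. -}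

module Defs where

open import Data.Nat as ℕ using (ℕ; zero; suc; _∸_; _^_; _≟_)
open import Data.Fin using (Fin)
open import Data.Bool using (Bool; true; false; _∧_; not; if_then_else_)
open import Data.List using (List; []; _∷_)
open import Data.Integer using (+_)
open import Data.Rational using (ℚ; 0ℚ; 1ℚ; _+_; _*_; _/_)
open import Relation.Nullary.Decidable using (⌊_⌋)

ℕ→ℚ : ℕ → ℚ
ℕ→ℚ k = + k / 1

record Affine (k : ℕ) : Set where
  constructor affine
  field
    coeffs : Fin k → ℚ
    const  : ℚ

sumFin : (k : ℕ) → (Fin k → ℚ) → ℚ
sumFin zero    f = 0ℚ
sumFin (suc k) f = f Fin.zero + sumFin k (λ i → f (Fin.suc i))
  where import Data.Fin as Fin

evalAffine : {k : ℕ} → Affine k → (Fin k → ℚ) → ℚ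
evalAffine {k} (affine c c₀) x = sumFin k (λ i → c i * x i) + c₀

data Literal : Set where
  n≡ : ℕ → Literal
  n≢ : ℕ → Literal

holdsLit : Literal → ℕ → Bool
holdsLit (n≡ c) n = ⌊ n ≟ c ⌋
holdsLit (n≢ c) n = not ⌊ n ≟ c ⌋

Constraint : Set
Constraint = List Literal

holds : Constraint → ℕ → Bool
holds []       n = true
holds (l ∷ ls) n = holdsLit l n ∧ holds ls n

charFun : Constraint → ℕ → ℚ
charFun ψ n = if holds ψ n then 1ℚ else 0ℚ

-- one summand [[ψ]] · α · n^a · b^n, with b ∈ ℕ_{≥1} written as b = suc b'
record PETerm (k : ℕ) : Set where
  constructor peTerm
  field
    ψ  : Constraint
    α  : Affine k
    a  : ℕ
    b' : ℕ

base : {k : ℕ} → PETerm k → ℕ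
base t = suc (PETerm.b' t)

PE : ℕ → Set
PE k = List (PETerm k)

evalTerm : {k : ℕ} → PETerm k → ℕ → (Fin k → ℚ) → ℚ
evalTerm t n x =
  charFun (PETerm.ψ t) n * (evalAffine (PETerm.α t) x * ℕ→ℚ (n ^ PETerm.a t ℕ.* base t ^ n))

-- value of p for n ↦ n and the given assignment of x (so evalPE p t x is the value of p[n/t])
evalPE : {k : ℕ} → PE k → ℕ → (Fin k → ℚ) → ℚ
evalPE []       n x = 0ℚ
evalPE (t ∷ ts) n x = evalTerm t n x + evalPE ts n x

sum1to : ℕ → (ℕ → ℚ) → ℚ
sum1to zero    f = 0ℚ
sum1to (suc n) f = sum1to n f + f (suc n)

module Submission where

-- S f n = Σ_{i=1}^n m^(n-i)·f(i-1) is the unique g with g 0 = 0 and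
-- g (n+1) = m·g n + f n, so it suffices to find, for each PE p, a PE q obeying
-- this recurrence.  It is linear and the coefficients α(x) do not depend on n,
-- so we solve it for scalar expressions (rational coefficients) and lift.
-- A scalar f is summable if a representable g solves the recurrence for some
-- initial value; subtracting g 0·m^n then gives the running sum.  Summability
-- is proved for ladders u j with u j (n+1) = β·u j n + γ·u (j-1) n: if β = m,
-- u (j+1)/γ is a solution for u j; if β ≠ m, u j is a combination of its own
-- m-difference and u (j-1).  The point indicators [n = c] (β = 0) and the
-- sequences C(n,j)·b^n (β = b) are ladders; absorption
-- n·C(n,j) = (j+1)·C(n,j+1) + j·C(n,j) yields the monomials n^a·b^n, and each
-- literal of a guard ψ only alters a sequence at a single point n = c.

open import Defs
open import Data.Nat as ℕ using (ℕ; zero; suc; _∸_; _^_; _≤_)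
import Data.Nat.Properties as ℕₚ
open import Data.Nat.Combinatorics using (_C_; nC1≡n; nCk+nC[k+1]≡[n+1]C[k+1])
open import Data.Nat.Tactic.RingSolver using () renaming (solve-∀ to solveℕ)
import Data.Nat.Coprimality as Coprime
import Data.Integer as ℤ
import Data.Integer.Properties as ℤₚ
open import Data.Rational using (ℚ; mkℚ; 0ℚ; 1ℚ; _+_; _*_; -_; _-_; _/_; 1/_; ↥_; ≢-nonZero)
open import Data.Rational.Properties using (+-*-commutativeRing; normalize-coprime)
import Data.Rational.Properties as ℚₚ
open import Data.Fin as Fin using (Fin)
open import Data.Bool using (if_then_else_; _∧_; true)
open import Data.List using (List; []; _∷_; _++_; map)
open import Data.Product using (Σ; _,_; _×_)
open import Data.Maybe.Base using (Maybe; just; nothing)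
open import Level using (0ℓ)
open import Relation.Nullary using (yes; no)
open import Relation.Nullary.Decidable using (isYes≗does)
open import Relation.Binary.PropositionalEquality
open import Tactic.RingSolver using (solve-∀)
import Tactic.RingSolver.Core.AlmostCommutativeRing as ACR
open ≡-Reasoning

ℚ-ring : ACR.AlmostCommutativeRing 0ℓ 0ℓ
ℚ-ring = ACR.fromCommutativeRing +-*-commutativeRing isZero
  where
  isZero : ∀ x → Maybe (0ℚ ≡ x)
  isZero x with x Data.Rational.≟ 0ℚ
  ... | yes x≡0 = just (sym x≡0)
  ... | no _    = nothing

ι : ℕ → ℚ
ι = ℕ→ℚ

-- ι k is already in normal form, so ι commutes with the operations on numerators.
ι-normal : ∀ k → ι k ≡ mkℚ (ℤ.+ k) 0 (Coprime.sym (Coprime.1-coprimeTo k))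
ι-normal k = normalize-coprime (Coprime.sym (Coprime.1-coprimeTo k))

ι-+ : ∀ a b → ι (a ℕ.+ b) ≡ ι a + ι b
ι-+ a b = begin
  ℤ.+ (a ℕ.+ b) / 1                       ≡⟨ cong (_/ 1) (ℤₚ.pos-+ a b) ⟩
  (ℤ.+ a ℤ.+ ℤ.+ b) / 1                   ≡⟨ cong₂ (λ u v → (u ℤ.+ v) / 1) (sym (ℤₚ.*-identityʳ (ℤ.+ a)))
                                                                          (sym (ℤₚ.*-identityʳ (ℤ.+ b))) ⟩
  (ℤ.+ a ℤ.* ℤ.+ 1 ℤ.+ ℤ.+ b ℤ.* ℤ.+ 1) / 1 ≡⟨ sym (cong₂ _+_ (ι-normal a) (ι-normal b)) ⟩
  ι a + ι b                               ∎

ι-* : ∀ a b → ι (a ℕ.* b) ≡ ι a * ι b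
ι-* a b = trans (cong (_/ 1) (ℤₚ.pos-* a b)) (sym (cong₂ _*_ (ι-normal a) (ι-normal b)))

ι-injective : ∀ {a b} → ι a ≡ ι b → a ≡ b
ι-injective {a} {b} eq = ℤₚ.+-injective (cong ↥_ (trans (sym (ι-normal a)) (trans eq (ι-normal b))))

inverse : (c : ℚ) → c ≢ 0ℚ → ℚ
inverse c c≢0 = 1/_ c {{≢-nonZero c≢0}}

inverse-cancel : ∀ {c} (c≢0 : c ≢ 0ℚ) x → inverse c c≢0 * (c * x) ≡ x
inverse-cancel {c} c≢0 x = begin
  inverse c c≢0 * (c * x)  ≡⟨ sym (ℚₚ.*-assoc (inverse c c≢0) c x) ⟩
  (inverse c c≢0 * c) * x  ≡⟨ cong (_* x) (ℚₚ.*-inverseˡ c {{≢-nonZero c≢0}}) ⟩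
  1ℚ * x                   ≡⟨ ℚₚ.*-identityˡ x ⟩
  x                        ∎

ι-suc≢0 : ∀ k → ι (suc k) ≢ 0ℚ
ι-suc≢0 k eq with ι-injective {suc k} {0} eq
... | ()

ι-difference≢0 : ∀ {a b} → a ≢ b → ι a - ι b ≢ 0ℚ
ι-difference≢0 {a} {b} a≢b eq = a≢b (ι-injective (begin
  ι a                ≡⟨ split (ι a) (ι b) ⟩
  (ι a - ι b) + ι b  ≡⟨ cong (_+ ι b) eq ⟩
  0ℚ + ι b           ≡⟨ ℚₚ.+-identityˡ (ι b) ⟩
  ι b                ∎))
  where
  split : ∀ x y → x ≡ (x - y) + y
  split = solve-∀ ℚ-ring

ι-linear : ∀ a x b y → ι (a ℕ.* x ℕ.+ b ℕ.* y) ≡ ι a * ι x + ι b * ι y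
ι-linear a x b y = trans (ι-+ (a ℕ.* x) (b ℕ.* y)) (cong₂ _+_ (ι-* a x) (ι-* b y))

data ScalarTerm : Set where
  term : Constraint → ℚ → ℕ → ℕ → ScalarTerm

evalST : ScalarTerm → ℕ → ℚ
evalST (term ψ r a b') n = charFun ψ n * (r * ι (n ^ a ℕ.* suc b' ^ n))

ScalarPE : Set
ScalarPE = List ScalarTerm

evalS : ScalarPE → ℕ → ℚ
evalS []       n = 0ℚ
evalS (t ∷ ts) n = evalST t n + evalS ts n

Representable : (ℕ → ℚ) → Set
Representable f = Σ ScalarPE λ q → evalS q ≗ f

rep-ext : ∀ {f g} → f ≗ g → Representable f → Representable g
rep-ext f≗g (q , q≗f) = q , λ n → trans (q≗f n) (f≗g n)

rep-zero : Representable (λ _ → 0ℚ)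
rep-zero = [] , λ _ → refl

rep-term : ∀ t → Representable (evalST t)
rep-term t = t ∷ [] , λ n → ℚₚ.+-identityʳ (evalST t n)

evalS-++ : ∀ q q′ n → evalS (q ++ q′) n ≡ evalS q n + evalS q′ n
evalS-++ []      q′ n = sym (ℚₚ.+-identityˡ (evalS q′ n))
evalS-++ (t ∷ q) q′ n = trans (cong (evalST t n +_) (evalS-++ q q′ n))
                              (sym (ℚₚ.+-assoc (evalST t n) (evalS q n) (evalS q′ n)))

rep-+ : ∀ {f g} → Representable f → Representable g → Representable (λ n → f n + g n)
rep-+ (q , q≗f) (q′ , q′≗g) = q ++ q′ , λ n → trans (evalS-++ q q′ n) (cong₂ _+_ (q≗f n) (q′≗g n))

scaleST : ℚ → ScalarTerm → ScalarTerm
scaleST c (term ψ r a b') = term ψ (c * r) a b'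

evalS-scale : ∀ c q n → evalS (map (scaleST c) q) n ≡ c * evalS q n
evalS-scale c []                  n = sym (ℚₚ.*-zeroʳ c)
evalS-scale c (term ψ r a b' ∷ q) n =
  trans (cong₂ _+_ (pull (charFun ψ n) c r _) (evalS-scale c q n))
        (sym (ℚₚ.*-distribˡ-+ c _ _))
  where
  pull : ∀ f c r x → f * ((c * r) * x) ≡ c * (f * (r * x))
  pull = solve-∀ ℚ-ring

rep-scale : ∀ c {f} → Representable f → Representable (λ n → c * f n)
rep-scale c (q , q≗f) = map (scaleST c) q , λ n → trans (evalS-scale c q n) (cong (c *_) (q≗f n))

raiseST : ScalarTerm → ScalarTerm
raiseST (term ψ r a b') = term ψ r (suc a) b'

evalS-raise : ∀ q n → evalS (map raiseST q) n ≡ ι n * evalS q n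
evalS-raise []                  n = sym (ℚₚ.*-zeroʳ (ι n))
evalS-raise (term ψ r a b' ∷ q) n =
  trans (cong₂ _+_ raised (evalS-raise q n)) (sym (ℚₚ.*-distribˡ-+ (ι n) _ _))
  where
  pull : ∀ f r m x → f * (r * (m * x)) ≡ m * (f * (r * x))
  pull = solve-∀ ℚ-ring
  raised : evalST (term ψ r (suc a) b') n ≡ ι n * evalST (term ψ r a b') n
  raised = trans (cong (λ z → charFun ψ n * (r * z))
                       (trans (cong ι (ℕₚ.*-assoc n (n ^ a) (suc b' ^ n))) (ι-* n _)))
                 (pull (charFun ψ n) r (ι n) _)

rep-raise : ∀ {f} → Representable f → Representable (λ n → ι n * f n)
rep-raise (q , q≗f) = map raiseST q , λ n → trans (evalS-raise q n) (cong (ι n *_) (q≗f n))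

rep-unscale : ∀ {c f} → c ≢ 0ℚ → Representable (λ n → c * f n) → Representable f
rep-unscale {c} {f} c≢0 rep = rep-ext (λ n → inverse-cancel c≢0 (f n)) (rep-scale (inverse c c≢0) rep)

δ : ℕ → ℕ → ℚ
δ c n = charFun (n≡ c ∷ []) n

δ-shift : ∀ c n → δ (suc c) (suc n) ≡ δ c n
δ-shift c n = cong (λ b → if b ∧ true then 1ℚ else 0ℚ)
                   (trans (isYes≗does (suc n ℕ.≟ suc c)) (sym (isYes≗does (n ℕ.≟ c))))

evalST-constant : ∀ ψ r n → evalST (term ψ r 0 0) n ≡ charFun ψ n * r
evalST-constant ψ r n =
  trans (cong (λ k → charFun ψ n * (r * ι k)) (trans (ℕₚ.+-identityʳ (1 ^ n)) (ℕₚ.^-zeroˡ n)))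
        (cong (charFun ψ n *_) (ℚₚ.*-identityʳ r))

rep-point : ∀ c → Representable (δ c)
rep-point c = rep-ext (λ n → trans (evalST-constant (n≡ c ∷ []) 1ℚ n) (ℚₚ.*-identityʳ (δ c n)))
                      (rep-term (term (n≡ c ∷ []) 1ℚ 0 0))

rep-power : ∀ m → Representable (λ n → ι (m ^ n))
rep-power zero     = rep-ext δ0≡0^n (rep-point 0)
  where
  δ0≡0^n : ∀ n → δ 0 n ≡ ι (0 ^ n)
  δ0≡0^n zero    = refl
  δ0≡0^n (suc n) = refl
rep-power (suc b') = rep-ext power (rep-term (term [] 1ℚ 0 b'))
  where
  power : ∀ n → 1ℚ * (1ℚ * ι (1 ℕ.* suc b' ^ n)) ≡ ι (suc b' ^ n)
  power n = trans (ℚₚ.*-identityˡ (1ℚ * ι (1 ℕ.* suc b' ^ n)))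
                  (trans (ℚₚ.*-identityˡ (ι (1 ℕ.* suc b' ^ n))) (cong ι (ℕₚ.*-identityˡ (suc b' ^ n))))

record Solves (m : ℕ) (f g : ℕ → ℚ) : Set where
  constructor solves
  field step : ∀ n → g (suc n) ≡ ι m * g n + f n
open Solves

solves-ext : ∀ {m f f′ g g′} → f ≗ f′ → g ≗ g′ → Solves m f g → Solves m f′ g′
solves-ext {m} {f} {f′} {g} {g′} f≗f′ g≗g′ s = solves λ n → begin
  g′ (suc n)      ≡⟨ sym (g≗g′ (suc n)) ⟩
  g (suc n)       ≡⟨ step s n ⟩
  ι m * g n + f n ≡⟨ cong₂ (λ u v → ι m * u + v) (g≗g′ n) (f≗f′ n) ⟩
  ι m * g′ n + f′ n ∎

solves-+ : ∀ {m f f′ g g′} → Solves m f g → Solves m f′ g′ →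
           Solves m (λ n → f n + f′ n) (λ n → g n + g′ n)
solves-+ {m} {f} {f′} {g} {g′} s s′ = solves λ n →
  trans (cong₂ _+_ (step s n) (step s′ n)) (regroup (ι m) (g n) (g′ n) (f n) (f′ n))
  where
  regroup : ∀ M a b c d → (M * a + c) + (M * b + d) ≡ M * (a + b) + (c + d)
  regroup = solve-∀ ℚ-ring

solves-scale : ∀ {m f g} c → Solves m f g → Solves m (λ n → c * f n) (λ n → c * g n)
solves-scale {m} {f} {g} c s = solves λ n → trans (cong (c *_) (step s n)) (distribute c (ι m) (g n) (f n))
  where
  distribute : ∀ c M a b → c * (M * a + b) ≡ M * (c * a) + c * b
  distribute = solve-∀ ℚ-ring

solves-zero : ∀ {m} → Solves m (λ _ → 0ℚ) (λ _ → 0ℚ)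
solves-zero {m} = solves λ _ → annihilate (ι m)
  where
  annihilate : ∀ M → 0ℚ ≡ M * 0ℚ + 0ℚ
  annihilate = solve-∀ ℚ-ring

Summable : ℕ → (ℕ → ℚ) → Set
Summable m f = Σ (ℕ → ℚ) λ g → Representable g × Solves m f g

summable-ext : ∀ {m f f′} → f ≗ f′ → Summable m f → Summable m f′
summable-ext f≗f′ (g , rg , s) = g , rg , solves-ext f≗f′ (λ _ → refl) s

summable-zero : ∀ {m} → Summable m (λ _ → 0ℚ)
summable-zero = (λ _ → 0ℚ) , rep-zero , solves-zero

summable-+ : ∀ {m f f′} → Summable m f → Summable m f′ → Summable m (λ n → f n + f′ n)
summable-+ (g , rg , s) (g′ , rg′ , s′) = _ , rep-+ rg rg′ , solves-+ s s′

summable-scale : ∀ {m f} c → Summable m f → Summable m (λ n → c * f n)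
summable-scale c (g , rg , s) = _ , rep-scale c rg , solves-scale c s

summable-unscale : ∀ {m c f} → c ≢ 0ℚ → Summable m (λ n → c * f n) → Summable m f
summable-unscale {m} {c} {f} c≢0 sf =
  summable-ext (λ n → inverse-cancel c≢0 (f n)) (summable-scale (inverse c c≢0) sf)

difference-summable : ∀ {m g} → Representable g → Summable m (λ n → g (suc n) - ι m * g n)
difference-summable {m} {g} rg = g , rg , solves λ n → split (g (suc n)) (ι m * g n)
  where
  split : ∀ x y → x ≡ y + (x - y)
  split = solve-∀ ℚ-ring

-- If g (n+1) = β·g n + f n with β ≠ m and f is summable, then so is g: its
-- m-difference is (β - m)·g n + f n.
peel : ∀ {m β f g} → β ≢ m → Representable g → Solves β f g → Summable m f → Summable m g
peel {m} {β} {f} {g} β≢m rg s sf =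
  summable-unscale (ι-difference≢0 β≢m)
    (summable-ext difference (summable-+ (difference-summable rg) (summable-scale (- 1ℚ) sf)))
  where
  cancel : ∀ B M a b → ((B * a + b) - M * a) + - 1ℚ * b ≡ (B - M) * a
  cancel = solve-∀ ℚ-ring
  difference : ∀ n → (g (suc n) - ι m * g n) + - 1ℚ * f n ≡ (ι β - ι m) * g n
  difference n = trans (cong (λ y → (y - ι m * g n) + - 1ℚ * f n) (step s n))
                       (cancel (ι β) (ι m) (g n) (f n))

record Ladder : Set where
  field
    rung               : ℕ → ℕ → ℚ
    ratio              : ℕ
    coupling           : ℚ
    coupling≢0         : coupling ≢ 0ℚ
    rung-representable : ∀ j → Representable (rung j)
    climb-base         : Solves ratio (λ _ → 0ℚ) (rung 0)
    climb              : ∀ j → Solves ratio (λ n → coupling * rung j n) (rung (suc j))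

  -- Away from resonance each rung is peeled off using the one below it.
  nonResonant : ∀ {m} → ratio ≢ m → ∀ j → Summable m (rung j)
  nonResonant β≢m zero    = peel β≢m (rung-representable 0) climb-base summable-zero
  nonResonant β≢m (suc j) = peel β≢m (rung-representable (suc j)) (climb j)
                                 (summable-scale coupling (nonResonant β≢m j))

  -- Every rung is summable for every multiplier; at resonance (m = β) the
  -- rung above, divided by γ, is a solution.
  summable : ∀ m j → Summable m (rung j)
  summable m j with ratio ℕ.≟ m
  ... | yes refl = summable-unscale coupling≢0 (rung (suc j) , rung-representable (suc j) , climb j)
  ... | no β≢m   = nonResonant β≢m j

-- The point indicators form a ladder with ratio 0: [n+1 = c+1] = [n = c].
pointLadder : Ladder
pointLadder = record
  { rung               = δ
  ; ratio              = 0
  ; coupling           = 1ℚ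
  ; coupling≢0         = λ ()
  ; rung-representable = rep-point
  ; climb-base         = solves λ n → vanish (δ 0 n)
  ; climb              = λ j → solves λ n → trans (δ-shift j n) (shift (δ (suc j) n) (δ j n))
  }
  where
  vanish : ∀ x → 0ℚ ≡ 0ℚ * x + 0ℚ
  vanish = solve-∀ ℚ-ring
  shift : ∀ x y → y ≡ 0ℚ * x + 1ℚ * y
  shift = solve-∀ ℚ-ring

absorption : ∀ n j → n ℕ.* (n C j) ≡ suc j ℕ.* (n C suc j) ℕ.+ j ℕ.* (n C j)
absorption zero    zero    = refl
absorption zero    (suc j) = sym (cong₂ ℕ._+_ (ℕₚ.*-zeroʳ (suc (suc j))) (ℕₚ.*-zeroʳ (suc j)))
absorption (suc n) zero    =
  trans (ℕₚ.*-identityʳ (suc n)) (sym (trans (ℕₚ.+-identityʳ _) (trans (ℕₚ.*-identityˡ _) (nC1≡n (suc n)))))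
absorption (suc n) (suc j) = begin
  suc n ℕ.* (suc n C suc j)
    ≡⟨ cong (suc n ℕ.*_) (sym (pascal j)) ⟩
  suc n ℕ.* (A₀ ℕ.+ A₁)
    ≡⟨ expand n A₀ A₁ ⟩
  A₀ ℕ.+ A₁ ℕ.+ (n ℕ.* A₀ ℕ.+ n ℕ.* A₁)
    ≡⟨ cong₂ (λ u v → A₀ ℕ.+ A₁ ℕ.+ (u ℕ.+ v)) (absorption n j) (absorption n (suc j)) ⟩
  A₀ ℕ.+ A₁ ℕ.+ ((suc j ℕ.* A₁ ℕ.+ j ℕ.* A₀) ℕ.+ (suc (suc j) ℕ.* A₂ ℕ.+ suc j ℕ.* A₁))
    ≡⟨ regroup j A₀ A₁ A₂ ⟩
  suc (suc j) ℕ.* (A₁ ℕ.+ A₂) ℕ.+ suc j ℕ.* (A₀ ℕ.+ A₁)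
    ≡⟨ cong₂ (λ u v → suc (suc j) ℕ.* u ℕ.+ suc j ℕ.* v) (pascal (suc j)) (pascal j) ⟩
  suc (suc j) ℕ.* (suc n C suc (suc j)) ℕ.+ suc j ℕ.* (suc n C suc j) ∎
  where
  A₀ = n C j
  A₁ = n C suc j
  A₂ = n C suc (suc j)
  pascal : ∀ k → n C k ℕ.+ n C suc k ≡ suc n C suc k
  pascal = nCk+nC[k+1]≡[n+1]C[k+1] n
  expand : ∀ n a b → suc n ℕ.* (a ℕ.+ b) ≡ a ℕ.+ b ℕ.+ (n ℕ.* a ℕ.+ n ℕ.* b)
  expand = solveℕ
  regroup : ∀ j a b c → a ℕ.+ b ℕ.+ ((suc j ℕ.* b ℕ.+ j ℕ.* a) ℕ.+ (suc (suc j) ℕ.* c ℕ.+ suc j ℕ.* b))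
                        ≡ suc (suc j) ℕ.* (b ℕ.+ c) ℕ.+ suc j ℕ.* (a ℕ.+ b)
  regroup = solveℕ

binomialPower : ℕ → ℕ → ℕ → ℚ
binomialPower b j n = ι ((n C j) ℕ.* b ^ n)

binomialPower-absorption : ∀ b j n →
  ι n * binomialPower b j n ≡ ι (suc j) * binomialPower b (suc j) n + ι j * binomialPower b j n
binomialPower-absorption b j n = begin
  ι n * ι ((n C j) ℕ.* b ^ n)
    ≡⟨ sym (ι-* n ((n C j) ℕ.* b ^ n)) ⟩
  ι (n ℕ.* ((n C j) ℕ.* b ^ n))
    ≡⟨ cong ι (sym (ℕₚ.*-assoc n (n C j) (b ^ n))) ⟩
  ι (n ℕ.* (n C j) ℕ.* b ^ n)
    ≡⟨ cong (λ k → ι (k ℕ.* b ^ n)) (absorption n j) ⟩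
  ι ((suc j ℕ.* (n C suc j) ℕ.+ j ℕ.* (n C j)) ℕ.* b ^ n)
    ≡⟨ cong ι (distribute (suc j) (n C suc j) j (n C j) (b ^ n)) ⟩
  ι (suc j ℕ.* ((n C suc j) ℕ.* b ^ n) ℕ.+ j ℕ.* ((n C j) ℕ.* b ^ n))
    ≡⟨ ι-linear (suc j) ((n C suc j) ℕ.* b ^ n) j ((n C j) ℕ.* b ^ n) ⟩
  ι (suc j) * binomialPower b (suc j) n + ι j * binomialPower b j n ∎
  where
  distribute : ∀ a x c y z → (a ℕ.* x ℕ.+ c ℕ.* y) ℕ.* z ≡ a ℕ.* (x ℕ.* z) ℕ.+ c ℕ.* (y ℕ.* z)
  distribute = solveℕ

-- C(n,j)·b^n is representable: by absorption,
-- (j+1)·C(n,j+1)·b^n = n·C(n,j)·b^n - j·C(n,j)·b^n.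
rep-binomialPower : ∀ b' j → Representable (binomialPower (suc b') j)
rep-binomialPower b' zero    = rep-ext power (rep-term (term [] 1ℚ 0 b'))
  where
  power : ∀ n → 1ℚ * (1ℚ * ι (1 ℕ.* suc b' ^ n)) ≡ binomialPower (suc b') 0 n
  power n = trans (ℚₚ.*-identityˡ (1ℚ * ι (1 ℕ.* suc b' ^ n)))
                  (ℚₚ.*-identityˡ (ι (1 ℕ.* suc b' ^ n)))
rep-binomialPower b' (suc j) =
  rep-unscale (ι-suc≢0 j) (rep-ext lower (rep-+ (rep-raise rep-j) (rep-scale (- ι j) rep-j)))
  where
  rep-j = rep-binomialPower b' j
  lower : ∀ n → ι n * binomialPower (suc b') j n + - ι j * binomialPower (suc b') j n
                ≡ ι (suc j) * binomialPower (suc b') (suc j) n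
  lower n = begin
    ι n * P + - ι j * P                   ≡⟨ cong (_+ - ι j * P) (binomialPower-absorption (suc b') j n) ⟩
    (ι (suc j) * P′ + ι j * P) + - ι j * P ≡⟨ shift (ι (suc j) * P′) (ι j) P ⟩
    ι (suc j) * P′                        ∎
    where
    P  = binomialPower (suc b') j n
    P′ = binomialPower (suc b') (suc j) n
    shift : ∀ a b c → (a + b * c) + - b * c ≡ a
    shift = solve-∀ ℚ-ring

-- For b ≥ 1 the sequences C(n,j)·b^n form a ladder with ratio and coupling b,
-- by Pascal's rule C(n+1,j+1) = C(n,j) + C(n,j+1).
binomialLadder : ℕ → Ladder
binomialLadder b' = record
  { rung               = binomialPower b
  ; ratio              = b
  ; coupling           = ι b
  ; coupling≢0         = ι-suc≢0 b'
  ; rung-representable = rep-binomialPower b'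
  ; climb-base         = solves ground
  ; climb              = λ j → solves (up j)
  }
  where
  b = suc b'
  ground : ∀ n → binomialPower b 0 (suc n) ≡ ι b * binomialPower b 0 n + 0ℚ
  ground n = begin
    ι (1 ℕ.* (b ℕ.* b ^ n))   ≡⟨ cong ι (ℕₚ.*-identityˡ (b ℕ.* b ^ n)) ⟩
    ι (b ℕ.* b ^ n)           ≡⟨ cong (λ k → ι (b ℕ.* k)) (sym (ℕₚ.*-identityˡ (b ^ n))) ⟩
    ι (b ℕ.* (1 ℕ.* b ^ n))   ≡⟨ ι-* b (1 ℕ.* b ^ n) ⟩
    ι b * ι (1 ℕ.* b ^ n)     ≡⟨ sym (ℚₚ.+-identityʳ _) ⟩
    ι b * binomialPower b 0 n + 0ℚ ∎
  up : ∀ j n → binomialPower b (suc j) (suc n)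
               ≡ ι b * binomialPower b (suc j) n + ι b * binomialPower b j n
  up j n = begin
    ι ((suc n C suc j) ℕ.* (b ℕ.* b ^ n))
      ≡⟨ cong (λ k → ι (k ℕ.* (b ℕ.* b ^ n))) (sym (nCk+nC[k+1]≡[n+1]C[k+1] n j)) ⟩
    ι (((n C j) ℕ.+ (n C suc j)) ℕ.* (b ℕ.* b ^ n))
      ≡⟨ cong ι (distribute (n C j) (n C suc j) b (b ^ n)) ⟩
    ι (b ℕ.* ((n C suc j) ℕ.* b ^ n) ℕ.+ b ℕ.* ((n C j) ℕ.* b ^ n))
      ≡⟨ ι-linear b ((n C suc j) ℕ.* b ^ n) b ((n C j) ℕ.* b ^ n) ⟩
    ι b * binomialPower b (suc j) n + ι b * binomialPower b j n ∎
    where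
    distribute : ∀ x y c z → (x ℕ.+ y) ℕ.* (c ℕ.* z) ≡ c ℕ.* (y ℕ.* z) ℕ.+ c ℕ.* (x ℕ.* z)
    distribute = solveℕ

-- n^a·C(n,j)·b^n is summable, by induction on a: absorption lowers a by one.
weighted-summable : ∀ m b' a j → Summable m (λ n → ι (n ^ a) * binomialPower (suc b') j n)
weighted-summable m b' zero    j =
  summable-ext (λ n → sym (ℚₚ.*-identityˡ (binomialPower (suc b') j n))) (Ladder.summable (binomialLadder b') m j)
weighted-summable m b' (suc a) j =
  summable-ext raise
    (summable-+ (summable-scale (ι (suc j)) (weighted-summable m b' a (suc j)))
                (summable-scale (ι j) (weighted-summable m b' a j)))
  where
  B = binomialPower (suc b')
  regroup : ∀ N c c′ P P′ → c * (N * P′) + c′ * (N * P) ≡ N * (c * P′ + c′ * P)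
  regroup = solve-∀ ℚ-ring
  raise : ∀ n → ι (suc j) * (ι (n ^ a) * B (suc j) n) + ι j * (ι (n ^ a) * B j n)
                ≡ ι (n ^ suc a) * B j n
  raise n = begin
    ι (suc j) * (ι (n ^ a) * B (suc j) n) + ι j * (ι (n ^ a) * B j n)
      ≡⟨ regroup (ι (n ^ a)) (ι (suc j)) (ι j) (B j n) (B (suc j) n) ⟩
    ι (n ^ a) * (ι (suc j) * B (suc j) n + ι j * B j n)
      ≡⟨ cong (ι (n ^ a) *_) (sym (binomialPower-absorption (suc b') j n)) ⟩
    ι (n ^ a) * (ι n * B j n)
      ≡⟨ sym (ℚₚ.*-assoc (ι (n ^ a)) (ι n) (B j n)) ⟩
    (ι (n ^ a) * ι n) * B j n
      ≡⟨ cong (_* B j n) (trans (sym (ι-* (n ^ a) n)) (cong ι (ℕₚ.*-comm (n ^ a) n))) ⟩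
    ι (n ^ suc a) * B j n ∎

monomial-summable : ∀ m a b' → Summable m (λ n → ι (n ^ a ℕ.* suc b' ^ n))
monomial-summable m a b' = summable-ext monomial (weighted-summable m b' a 0)
  where
  monomial : ∀ n → ι (n ^ a) * ι (1 ℕ.* suc b' ^ n) ≡ ι (n ^ a ℕ.* suc b' ^ n)
  monomial n = trans (sym (ι-* (n ^ a) (1 ℕ.* suc b' ^ n))) (cong (λ k → ι (n ^ a ℕ.* k)) (ℕₚ.*-identityˡ (suc b' ^ n)))

guard-≡ : ∀ c ψ (T : ℕ → ℚ) n → charFun (n≡ c ∷ ψ) n * T n ≡ (charFun ψ c * T c) * δ c n
guard-≡ c ψ T n with n ℕ.≟ c
... | yes refl = sym (ℚₚ.*-identityʳ (charFun ψ n * T n))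
... | no _     = trans (ℚₚ.*-zeroˡ (T n)) (sym (ℚₚ.*-zeroʳ (charFun ψ c * T c)))

guard-≢ : ∀ c ψ (T : ℕ → ℚ) n →
  charFun (n≢ c ∷ ψ) n * T n ≡ charFun ψ n * T n + - (charFun ψ c * T c) * δ c n
guard-≢ c ψ T n with n ℕ.≟ c
... | yes refl = vanish (charFun ψ n * T n) (T n)
  where
  vanish : ∀ x y → 0ℚ * y ≡ x + - x * 1ℚ
  vanish = solve-∀ ℚ-ring
... | no _     = keep (charFun ψ n * T n) (charFun ψ c * T c)
  where
  keep : ∀ x y → x ≡ x + - y * 0ℚ
  keep = solve-∀ ℚ-ring

guard-summable : ∀ {m T} ψ → Summable m T → Summable m (λ n → charFun ψ n * T n)
guard-summable []         sT = summable-ext (λ n → sym (ℚₚ.*-identityˡ _)) sT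
guard-summable {m} {T} (n≡ c ∷ ψ) sT =
  summable-ext (λ n → sym (guard-≡ c ψ T n))
    (summable-scale (charFun ψ c * T c) (Ladder.summable pointLadder m c))
guard-summable {m} {T} (n≢ c ∷ ψ) sT =
  summable-ext (λ n → sym (guard-≢ c ψ T n))
    (summable-+ (guard-summable ψ sT)
                (summable-scale (- (charFun ψ c * T c)) (Ladder.summable pointLadder m c)))

term-summable : ∀ m ψ a b' → Summable m (λ n → charFun ψ n * ι (n ^ a ℕ.* suc b' ^ n))
term-summable m ψ a b' = guard-summable ψ (monomial-summable m a b')

RunningSum : ℕ → (ℕ → ℚ) → (ℕ → ℚ) → Set
RunningSum m f g = g 0 ≡ 0ℚ × Solves m f g

running-ext : ∀ {m f f′ g g′} → f ≗ f′ → g ≗ g′ → RunningSum m f g → RunningSum m f′ g′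
running-ext f≗f′ g≗g′ (g₀ , s) = trans (sym (g≗g′ 0)) g₀ , solves-ext f≗f′ g≗g′ s

running-+ : ∀ {m f f′ g g′} → RunningSum m f g → RunningSum m f′ g′ →
            RunningSum m (λ n → f n + f′ n) (λ n → g n + g′ n)
running-+ (g₀ , s) (g′₀ , s′) = trans (cong₂ _+_ g₀ g′₀) (ℚₚ.+-identityʳ 0ℚ) , solves-+ s s′

running-scale : ∀ {m f g} c → RunningSum m f g → RunningSum m (λ n → c * f n) (λ n → c * g n)
running-scale c (g₀ , s) = trans (cong (c *_) g₀) (ℚₚ.*-zeroʳ c) , solves-scale c s

-- Correcting the initial value: if g solves the recurrence, so does
-- g n - g 0 · m^n, which starts at 0.
summable⇒running : ∀ {m f} → Summable m f → Σ ScalarPE λ q → RunningSum m f (evalS q)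
summable⇒running {m} {f} (g , rg , s) with rep-+ rg (rep-scale (- g 0) (rep-power m))
... | q , q≗h = q , running-ext (λ n → drop (f n) (g 0)) (λ n → sym (q≗h n))
                                 (start (g 0) , solves-+ s (solves-scale (- g 0) powers))
  where
  start : ∀ x → x + - x * 1ℚ ≡ 0ℚ
  start = solve-∀ ℚ-ring
  drop : ∀ x y → x + - y * 0ℚ ≡ x
  drop = solve-∀ ℚ-ring
  annihilate : ∀ M x → M * x ≡ M * x + 0ℚ
  annihilate = solve-∀ ℚ-ring
  powers : Solves m (λ _ → 0ℚ) (λ n → ι (m ^ n))
  powers = solves λ n → trans (ι-* m (m ^ n)) (annihilate (ι m) (ι (m ^ n)))

sum1to-cong : ∀ n {f g : ℕ → ℚ} → (∀ i → i ≤ n → f i ≡ g i) → sum1to n f ≡ sum1to n g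
sum1to-cong zero    f≗g = refl
sum1to-cong (suc n) f≗g =
  cong₂ _+_ (sum1to-cong n (λ i i≤n → f≗g i (ℕₚ.m≤n⇒m≤1+n i≤n))) (f≗g (suc n) ℕₚ.≤-refl)

sum1to-scale : ∀ n c (f : ℕ → ℚ) → sum1to n (λ i → c * f i) ≡ c * sum1to n f
sum1to-scale zero    c f = sym (ℚₚ.*-zeroʳ c)
sum1to-scale (suc n) c f = trans (cong (_+ c * f (suc n)) (sum1to-scale n c f))
                                 (sym (ℚₚ.*-distribˡ-+ c (sum1to n f) (f (suc n))))

weightedSum : ℕ → (ℕ → ℚ) → ℕ → ℚ
weightedSum m f n = sum1to n (λ i → ι (m ^ (n ∸ i)) * f (i ∸ 1))

weightedSum-running : ∀ m f → RunningSum m f (weightedSum m f)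
weightedSum-running m f = refl , solves λ n →
  cong₂ _+_ (trans (sum1to-cong n (older n)) (sum1to-scale n (ι m) (summand n)))
            (trans (cong (λ k → ι (m ^ k) * f n) (ℕₚ.n∸n≡0 n)) (ℚₚ.*-identityˡ (f n)))
  where
  summand : ℕ → ℕ → ℚ
  summand n i = ι (m ^ (n ∸ i)) * f (i ∸ 1)
  older : ∀ n i → i ≤ n → summand (suc n) i ≡ ι m * summand n i
  older n i i≤n = begin
    ι (m ^ (suc n ∸ i)) * f (i ∸ 1)         ≡⟨ cong (λ k → ι (m ^ k) * f (i ∸ 1)) (ℕₚ.+-∸-assoc 1 i≤n) ⟩
    ι (m ℕ.* m ^ (n ∸ i)) * f (i ∸ 1)       ≡⟨ cong (_* f (i ∸ 1)) (ι-* m (m ^ (n ∸ i))) ⟩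
    (ι m * ι (m ^ (n ∸ i))) * f (i ∸ 1)     ≡⟨ ℚₚ.*-assoc (ι m) (ι (m ^ (n ∸ i))) (f (i ∸ 1)) ⟩
    ι m * summand n i                        ∎

running-unique : ∀ {m f g h} → RunningSum m f g → RunningSum m f h → g ≗ h
running-unique (g₀ , _) (h₀ , _) zero = trans g₀ (sym h₀)
running-unique {m} {f} rg@(_ , sg) rh@(_ , sh) (suc n) =
  trans (step sg n) (trans (cong (λ y → ι m * y + f n) (running-unique rg rh n)) (sym (step sh n)))

scaleAffine : ∀ {k} → ℚ → Affine k → Affine k
scaleAffine r (affine c c₀) = affine (λ i → r * c i) (r * c₀)

sumFin-scale : ∀ k r (c x : Fin k → ℚ) → sumFin k (λ i → (r * c i) * x i) ≡ r * sumFin k (λ i → c i * x i)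
sumFin-scale zero    r c x = sym (ℚₚ.*-zeroʳ r)
sumFin-scale (suc k) r c x =
  trans (cong ((r * c Fin.zero) * x Fin.zero +_) (sumFin-scale k r (λ i → c (Fin.suc i)) (λ i → x (Fin.suc i))))
        (factor r (c Fin.zero) (x Fin.zero) (sumFin k (λ i → c (Fin.suc i) * x (Fin.suc i))))
  where
  factor : ∀ r a b s → (r * a) * b + r * s ≡ r * (a * b + s)
  factor = solve-∀ ℚ-ring

evalAffine-scale : ∀ {k} r (α : Affine k) x → evalAffine (scaleAffine r α) x ≡ r * evalAffine α x
evalAffine-scale {k} r (affine c c₀) x =
  trans (cong (_+ r * c₀) (sumFin-scale k r c x)) (sym (ℚₚ.*-distribˡ-+ r (sumFin k (λ i → c i * x i)) c₀))

liftST : ∀ {k} → Affine k → ScalarTerm → PETerm k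
liftST α (term ψ r a b') = peTerm ψ (scaleAffine r α) a b'

evalPE-lift : ∀ {k} (α : Affine k) q n x → evalPE (map (liftST α) q) n x ≡ evalAffine α x * evalS q n
evalPE-lift α []                  n x = sym (ℚₚ.*-zeroʳ (evalAffine α x))
evalPE-lift α (term ψ r a b' ∷ q) n x =
  trans (cong₂ _+_ lifted (evalPE-lift α q n x)) (sym (ℚₚ.*-distribˡ-+ (evalAffine α x) _ (evalS q n)))
  where
  regroup : ∀ f r A X → f * ((r * A) * X) ≡ A * (f * (r * X))
  regroup = solve-∀ ℚ-ring
  lifted : evalTerm (peTerm ψ (scaleAffine r α) a b') n x ≡ evalAffine α x * evalST (term ψ r a b') n
  lifted = trans (cong (λ z → charFun ψ n * (z * ι (n ^ a ℕ.* suc b' ^ n))) (evalAffine-scale r α x))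
                 (regroup (charFun ψ n) r (evalAffine α x) _)

evalPE-++ : ∀ {k} (p p′ : PE k) n x → evalPE (p ++ p′) n x ≡ evalPE p n x + evalPE p′ n x
evalPE-++ []      p′ n x = sym (ℚₚ.+-identityˡ (evalPE p′ n x))
evalPE-++ (t ∷ p) p′ n x = trans (cong (evalTerm t n x +_) (evalPE-++ p p′ n x))
                                 (sym (ℚₚ.+-assoc (evalTerm t n x) (evalPE p n x) (evalPE p′ n x)))

RunningSumPE : ∀ {k} → ℕ → PE k → PE k → Set
RunningSumPE m p q = ∀ x → RunningSum m (λ n → evalPE p n x) (λ n → evalPE q n x)

running-PE-++ : ∀ {k m} {p p′ q q′ : PE k} →
  RunningSumPE m p q → RunningSumPE m p′ q′ → RunningSumPE m (p ++ p′) (q ++ q′)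
running-PE-++ {p = p} {p′} {q} {q′} r r′ x =
  running-ext (λ n → sym (evalPE-++ p p′ n x)) (λ n → sym (evalPE-++ q q′ n x)) (running-+ (r x) (r′ x))

lift-running : ∀ {k m} ψ (α : Affine k) a b' →
  Σ ScalarPE (λ q → RunningSum m (λ n → charFun ψ n * ι (n ^ a ℕ.* suc b' ^ n)) (evalS q)) →
  Σ (PE k) λ q → RunningSumPE m (peTerm ψ α a b' ∷ []) q
lift-running ψ α a b' (q , r) = map (liftST α) q , λ x →
  running-ext (λ n → reorder (evalAffine α x) (charFun ψ n) (ι (n ^ a ℕ.* suc b' ^ n)))
              (λ n → sym (evalPE-lift α q n x))
              (running-scale (evalAffine α x) r)
  where
  reorder : ∀ a f T → a * (f * T) ≡ f * (a * T) + 0ℚ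
  reorder = solve-∀ ℚ-ring

running-term : ∀ {k} m (t : PETerm k) → Σ (PE k) λ q → RunningSumPE m (t ∷ []) q
running-term m (peTerm ψ α a b') = lift-running {m = m} ψ α a b' (summable⇒running (term-summable m ψ a b'))

running-PE : ∀ {k} m (p : PE k) → Σ (PE k) λ q → RunningSumPE m p q
running-PE m []      = [] , λ x → refl , solves-zero
running-PE m (t ∷ p) = append (running-term m t) (running-PE m p)
  where
  append : Σ (PE _) (RunningSumPE m (t ∷ [])) → Σ (PE _) (RunningSumPE m p) →
           Σ (PE _) (RunningSumPE m (t ∷ p))
  append (q , r) (q′ , r′) = q ++ q′ , running-PE-++ {m = m} {t ∷ []} {p} {q} {q′} r r′

lemma4 : (k m : ℕ) (p : PE k) →
    Σ (PE k) λ q → (n : ℕ) (x : Fin k → ℚ) →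
      evalPE q n x ≡ sum1to n (λ i → ℕ→ℚ (m ^ (n ∸ i)) * evalPE p (i ∸ 1) x)
lemma4 k m p =
  let (q , running) = running-PE m p
  in q , λ n x → running-unique (running x) (weightedSum-running m (λ j → evalPE p j x)) n
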